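{- Let $(x,y)\in\mathbb{Z}_{\geq0}^2$ with $x\ge 8$ or $y\ge 8$. Then $(x,y)$ is a $\mathcal{P}$-position of Wythoff's game if and only if $(x,y)$ is a $\mathcal{P}$-position of the misère variant of Wythoff's game with terminal set $T=\{(x,y):x+y\le 2\}$.
   Context: Moves (queen moves): from $(x,y)\in\mathbb{Z}_{\geq0}^2$ a player may move to any $(u,y)$ with $0\le u<x$, any $(x,v)$ with $0\le v<y$, or any $(x-t,y-t)$ with $1\le t\le\min(x,y)$. Wythoff's game: two players alternate these moves; the player who moves to $(0,0)$ wins. Its $\mathcal{P}$-positions are $\{(\lfloor n\phi\rfloor,\lfloor n(\phi+1)\rfloor)\}\cup\{(\lfloor n(\phi+1)\rfloor,\lfloor n\phi\rfloor)\}$, $n\ge0$, $\phi=\frac{1+\sqrt5}2$. Misère variant: same moves, but the game ends as soon as the position lies in $T=\{(x,y):x+y\le2\}$, and the player who moves the position into $T$ loses. A $\mathcal{P}$-position is one from which the previous player (the one who has just moved) wins with correct play. -}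

module Defs where

open import Data.Nat using (ℕ; _+_; _∸_; _≤_; _<_)
open import Relation.Nullary using (¬_)

data Move : ℕ → ℕ → ℕ → ℕ → Set where
  left : ∀ {x y u} → u < x → Move x y u y
  down : ∀ {x y v} → v < y → Move x y x v
  diag : ∀ {x y t} → 1 ≤ t → t ≤ x → t ≤ y → Move x y (x ∸ t) (y ∸ t)

-- Wythoff's game (normal play: the player who moves to (0,0), i.e. makes the
-- last move, wins).  WP = P-position (previous player wins), WN = N-position.
data WP : ℕ → ℕ → Set
data WN : ℕ → ℕ → Set

data WP where
  wP : ∀ {x y} → (∀ u v → Move x y u v → WN u v) → WP x y

data WN where
  wN : ∀ {x y u v} → Move x y u v → WP u v → WN x y

InT : ℕ → ℕ → Set
InT x y = x + y ≤ 2

-- Misère variant: the game stops as soon as the position lies in T and the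
-- player who moved into T loses.
data MP : ℕ → ℕ → Set
data MN : ℕ → ℕ → Set

data MP where
  mP : ∀ {x y} → ¬ InT x y → (∀ u v → Move x y u v → MN u v) → MP x y

data MN where
  mN-term : ∀ {x y} → InT x y → MN x y
  mN-move : ∀ {x y u v} → ¬ InT x y → Move x y u v → MP u v → MN x y

{-# OPTIONS --safe #-}
-- Inside the box [0,8)², the P-positions of each game form an explicit list, verified by
-- computation to be an independent, absorbing set of the box (its kernel). The two lists
-- differ, but meet exactly the same rows, columns and diagonals. A position outside the box
-- can move to every box position on its lines, so a move from outside into a box P-position
-- of one game can be redirected along a line into a box P-position of the other; by
-- induction on x + y the two games then have the same P- and N-positions outside the box.
module Submission where

open import Defs
open import Data.Empty using (⊥; ⊥-elim)
open import Data.Fin using (Fin; toℕ; fromℕ<)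
open import Data.Fin.Properties using (toℕ-fromℕ<)
import Data.Fin.Properties as Fin
open import Data.List using (List; []; _∷_)
open import Data.List.Membership.Propositional using (_∈_; _∉_; find)
open import Data.List.Relation.Unary.All as All using (All)
open import Data.List.Relation.Unary.Any as Any using (Any)
open import Data.Nat using (ℕ; _≤_; _<_; _+_; _∸_; _≟_; _<?_; _≤?_; s≤s)
open import Data.Nat.Induction using (<-wellFounded)
open import Data.Nat.Properties
open import Data.Nat.Tactic.RingSolver using (solve)
open import Data.Product using (∃; _×_; _,_; proj₁; proj₂; uncurry)
open import Data.Product.Properties using (≡-dec)
open import Data.Sum using (_⊎_; inj₁; inj₂)
open import Function.Bundles using (_⇔_; mk⇔)
open import Induction.WellFounded using (Acc; acc)
open import Relation.Binary.PropositionalEquality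
open import Relation.Nullary using (Dec; yes; no; ¬_)
open import Relation.Nullary.Decidable using (map′; ¬?; _×-dec_; _⊎-dec_; from-yes)
open import Data.List.Membership.DecPropositional (≡-dec _≟_ _≟_) using (_∈?_)

private variable
  x y u v u′ v′ t : ℕ

data Line : Set where
  row col diagonal : Line

OnLine : Line → ℕ → ℕ → ℕ → ℕ → Set
OnLine row      x y u v = y ≡ v
OnLine col      x y u v = x ≡ u
OnLine diagonal x y u v = x + v ≡ y + u

onLine? : ∀ ℓ x y u v → Dec (OnLine ℓ x y u v)
onLine? row      x y u v = y ≟ v
onLine? col      x y u v = x ≟ u
onLine? diagonal x y u v = x + v ≟ y + u

onLine-trans : ∀ ℓ → OnLine ℓ x y u v → OnLine ℓ u v u′ v′ → OnLine ℓ x y u′ v′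
onLine-trans row      p q = trans p q
onLine-trans col      p q = trans p q
onLine-trans {x = x} {y} {u} {v} {u′} {v′} diagonal p q = +-cancelʳ-≡ (u + v) _ _ (begin
  (x + v′) + (u + v) ≡⟨ solve (x ∷ v′ ∷ u ∷ v ∷ []) ⟩
  (x + v) + (u + v′) ≡⟨ cong₂ _+_ p q ⟩
  (y + u) + (v + u′) ≡⟨ solve (y ∷ u ∷ v ∷ u′ ∷ []) ⟩
  (y + u′) + (u + v) ∎)
  where open ≡-Reasoning

SameLine : ℕ → ℕ → ℕ → ℕ → Set
SameLine x y u v = ∃ λ ℓ → OnLine ℓ x y u v

diagonal-move : 1 ≤ t → Move (u + t) (v + t) u v
diagonal-move {t = t} {u} {v} 1≤t =
  subst₂ (Move (u + t) (v + t)) (m+n∸n≡m u t) (m+n∸n≡m v t)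
    (diag 1≤t (m≤n+m t u) (m≤n+m t v))

move-on-diagonal : u < x → x + v ≡ y + u → Move x y u v
move-on-diagonal {u = u} {x} {v} {y} u<x eq =
  subst₂ (λ a b → Move a b u v) (m+[n∸m]≡n (<⇒≤ u<x)) y≡v+t (diagonal-move (m<n⇒0<n∸m u<x))
  where
  open ≡-Reasoning
  y≡v+t : v + (x ∸ u) ≡ y
  y≡v+t = +-cancelʳ-≡ u _ _ (begin
    v + (x ∸ u) + u   ≡⟨ +-assoc v (x ∸ u) u ⟩
    v + (x ∸ u + u)   ≡⟨ cong (v +_) (m∸n+n≡m (<⇒≤ u<x)) ⟩
    v + x             ≡⟨ +-comm v x ⟩
    x + v             ≡⟨ eq ⟩
    y + u             ∎)

sameLine? : ∀ x y u v → Dec (SameLine x y u v)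
sameLine? x y u v =
  map′ (λ { (inj₁ p) → row , p ; (inj₂ (inj₁ p)) → col , p ; (inj₂ (inj₂ p)) → diagonal , p })
       (λ { (row , p) → inj₁ p ; (col , p) → inj₂ (inj₁ p) ; (diagonal , p) → inj₂ (inj₂ p) })
       (onLine? row x y u v ⊎-dec onLine? col x y u v ⊎-dec onLine? diagonal x y u v)

below-on-diagonal : ∀ {x y u v} → v < y → x + v ≡ y + u → u < x
below-on-diagonal {x} {y} {u} {v} v<y eq =
  +-cancelʳ-< v u x (subst (u + v <_) (trans (+-comm u y) (sym eq)) (+-monoʳ-< u v<y))

move⇒sameLine : Move x y u v → SameLine x y u v
move⇒sameLine (left _) = row , refl
move⇒sameLine (down _) = col , refl
move⇒sameLine {x} {y} (diag {t = t} _ t≤x t≤y) = diagonal , (begin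
  x + (y ∸ t)   ≡⟨ +-∸-assoc x t≤y ⟨
  (x + y) ∸ t   ≡⟨ cong (_∸ t) (+-comm x y) ⟩
  (y + x) ∸ t   ≡⟨ +-∸-assoc y t≤x ⟩
  y + (x ∸ t)   ∎)
  where open ≡-Reasoning

move⇒below : Move x y u v → u < x ⊎ v < y
move⇒below (left u<x)       = inj₁ u<x
move⇒below (down v<y)       = inj₂ v<y
move⇒below (diag 1≤t t≤x _) = inj₁ (∸-monoʳ-< 1≤t t≤x)

sameLine⇒move : SameLine x y u v → u < x ⊎ v < y → Move x y u v
sameLine⇒move (row      , refl) (inj₁ u<x) = left u<x
sameLine⇒move (row      , refl) (inj₂ y<y) = ⊥-elim (<-irrefl refl y<y)
sameLine⇒move (col      , refl) (inj₁ x<x) = ⊥-elim (<-irrefl refl x<x)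
sameLine⇒move (col      , refl) (inj₂ v<y) = down v<y
sameLine⇒move (diagonal , eq)   (inj₁ u<x) = move-on-diagonal u<x eq
sameLine⇒move (diagonal , eq)   (inj₂ v<y) = move-on-diagonal (below-on-diagonal v<y eq) eq

move? : ∀ x y u v → Dec (Move x y u v)
move? x y u v = map′ (uncurry sameLine⇒move) (λ m → move⇒sameLine m , move⇒below m)
                     (sameLine? x y u v ×-dec (u <? x ⊎-dec v <? y))

move-decreases : Move x y u v → u + v < x + y
move-decreases {v = v} (left u<x)               = +-monoˡ-< v u<x
move-decreases {x = x} (down v<y)               = +-monoʳ-< x v<y
move-decreases {y = y} (diag {t = t} 1≤t t≤x _) = +-mono-<-≤ (∸-monoʳ-< 1≤t t≤x) (m∸n≤m y t)

move-≤ : Move x y u v → u ≤ x × v ≤ y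
move-≤ (left u<x)                   = <⇒≤ u<x , ≤-refl
move-≤ (down v<y)                   = ≤-refl , <⇒≤ v<y
move-≤ {x} {y} (diag {t = t} _ _ _) = m∸n≤m x t , m∸n≤m y t

record QueenGame : Set₁ where
  field
    Terminal   : ℕ → ℕ → Set
    terminal?  : ∀ x y → Dec (Terminal x y)
    P N        : ℕ → ℕ → Set
    P-intro    : ¬ Terminal x y → (∀ u v → Move x y u v → N u v) → P x y
    P-elim     : P x y → Move x y u v → N u v
    N-terminal : Terminal x y → N x y
    N-intro    : ¬ Terminal x y → Move x y u v → P u v → N x y
    N-elim     : ¬ Terminal x y → N x y → ∃ λ u → ∃ λ v → Move x y u v × P u v
    P⇒¬N       : P x y → ¬ N x y

wythoff : QueenGame
wythoff = record
  { Terminal   = λ _ _ → ⊥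
  ; terminal?  = λ _ _ → no λ ()
  ; P          = WP
  ; N          = WN
  ; P-intro    = λ _ → wP
  ; P-elim     = λ { (wP next) → next _ _ }
  ; N-terminal = λ ()
  ; N-intro    = λ _ → wN
  ; N-elim     = λ { _ (wN m p) → _ , _ , m , p }
  ; P⇒¬N       = wp⇒¬wn
  }
  where
  wp⇒¬wn : WP x y → ¬ WN x y
  wp⇒¬wn (wP next) (wN m p) = wp⇒¬wn p (next _ _ m)

misère : QueenGame
misère = record
  { Terminal   = InT
  ; terminal?  = λ x y → x + y ≤? 2
  ; P          = MP
  ; N          = MN
  ; P-intro    = mP
  ; P-elim     = λ { (mP _ next) → next _ _ }
  ; N-terminal = mN-term
  ; N-intro    = mN-move
  ; N-elim     = λ { ¬t (mN-term t) → ⊥-elim (¬t t) ; _ (mN-move _ m p) → _ , _ , m , p }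
  ; P⇒¬N       = mp⇒¬mn
  }
  where
  mp⇒¬mn : MP x y → ¬ MN x y
  mp⇒¬mn (mP ¬t _)   (mN-term t)     = ¬t t
  mp⇒¬mn (mP _ next) (mN-move _ m p) = mp⇒¬mn p (next _ _ m)

module _ (G : QueenGame) where
  open QueenGame G

  module Kernel
    {R S : ℕ → ℕ → Set}
    (R-closed      : ∀ {x y u v} → R x y → Move x y u v → R u v)
    (S-independent : ∀ {x y u v} → S x y → Move x y u v → ¬ S u v)
    (S-nonterminal : ∀ {x y} → S x y → ¬ Terminal x y)
    (S-absorbing   : ∀ {x y} → R x y → ¬ Terminal x y → ¬ S x y →
                     ∃ λ u → ∃ λ v → Move x y u v × S u v)
    where

    private
      kernel⇒P : Acc _<_ (x + y) → R x y → S x y → P x y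
      nonkernel⇒N : Acc _<_ (x + y) → R x y → ¬ S x y → N x y
      kernel⇒P (acc rec) r s = P-intro (S-nonterminal s) λ _ _ m →
        nonkernel⇒N (rec (move-decreases m)) (R-closed r m) (S-independent s m)
      nonkernel⇒N {x} {y} (acc rec) r ¬s with terminal? x y
      ... | yes t = N-terminal t
      ... | no ¬t with S-absorbing r ¬t ¬s
      ...   | _ , _ , m , s = N-intro ¬t m (kernel⇒P (rec (move-decreases m)) (R-closed r m) s)

    S⇒P : R x y → S x y → P x y
    S⇒P = kernel⇒P (<-wellFounded _)

    ¬S⇒N : R x y → ¬ S x y → N x y
    ¬S⇒N = nonkernel⇒N (<-wellFounded _)

Box Outside : ℕ → ℕ → ℕ → Set
Box     n x y = x < n × y < n
Outside n x y = n ≤ x ⊎ n ≤ y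

box-closed : ∀ {n} → Box n x y → Move x y u v → Box n u v
box-closed (x<n , y<n) m with move-≤ m
... | u≤x , v≤y = ≤-<-trans u≤x x<n , ≤-<-trans v≤y y<n

outside⊎box : ∀ n x y → Outside n x y ⊎ Box n x y
outside⊎box n x y with n ≤? x | n ≤? y
... | yes n≤x | _       = inj₁ (inj₁ n≤x)
... | no  _   | yes n≤y = inj₁ (inj₂ n≤y)
... | no  n≰x | no  n≰y = inj₂ (≰⇒> n≰x , ≰⇒> n≰y)

outside-above-box : ∀ {n} → Outside n x y → Box n u v → u < x ⊎ v < y
outside-above-box (inj₁ n≤x) (u<n , _) = inj₁ (<-≤-trans u<n n≤x)
outside-above-box (inj₂ n≤y) (_ , v<n) = inj₂ (<-≤-trans v<n n≤y)

outside-≤-sum : ∀ {n} → Outside n x y → n ≤ x + y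
outside-≤-sum {x} {y} (inj₁ n≤x) = ≤-trans n≤x (m≤m+n x y)
outside-≤-sum {x} {y} (inj₂ n≤y) = ≤-trans n≤y (m≤n+m y x)

box-all : ∀ {n} {Q : ℕ → ℕ → Set} → (∀ (i j : Fin n) → Q (toℕ i) (toℕ j)) → Box n x y → Q x y
box-all {Q = Q} h (x<n , y<n) =
  subst₂ Q (toℕ-fromℕ< x<n) (toℕ-fromℕ< y<n) (h (fromℕ< x<n) (fromℕ< y<n))

Positions : Set
Positions = List (ℕ × ℕ)

record BoxKernel (n : ℕ) (G : QueenGame) : Set where
  open QueenGame G
  field
    positions : Positions
    in-box    : (x , y) ∈ positions → Box n x y
    P-in      : (x , y) ∈ positions → P x y
    N-out     : Box n x y → (x , y) ∉ positions → N x y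

  P⇒in : Box n x y → P x y → (x , y) ∈ positions
  P⇒in {x} {y} b p with (x , y) ∈? positions
  ... | yes s = s
  ... | no ¬s = ⊥-elim (P⇒¬N p (N-out b ¬s))

module _ (n : ℕ) (G : QueenGame) where
  open QueenGame G

  Absorbed : Positions → ℕ → ℕ → Set
  Absorbed S x y = (x , y) ∈ S ⊎ Terminal x y ⊎ Any (λ (u , v) → Move x y u v) S

  IsBoxKernel : Positions → Set
  IsBoxKernel S =
    All (λ (x , y) → Box n x y × ¬ Terminal x y × All (λ (u , v) → ¬ Move x y u v) S) S ×
    (∀ (i j : Fin n) → Absorbed S (toℕ i) (toℕ j))

  isBoxKernel? : ∀ S → Dec (IsBoxKernel S)
  isBoxKernel? S =
    All.all? (λ (x , y) → (x <? n ×-dec y <? n) ×-dec ¬? (terminal? x y) ×-dec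
                          All.all? (λ (u , v) → ¬? (move? x y u v)) S) S
    ×-dec Fin.all? (λ i → Fin.all? λ j →
            ((toℕ i , toℕ j) ∈? S) ⊎-dec terminal? (toℕ i) (toℕ j) ⊎-dec
            Any.any? (λ (u , v) → move? (toℕ i) (toℕ j) u v) S)

  boxKernel : ∀ S → IsBoxKernel S → BoxKernel n G
  boxKernel S (members , absorbing) = record
    { positions = S
    ; in-box    = in-box
    ; P-in      = λ s → S⇒P (in-box s) s
    ; N-out     = ¬S⇒N
    }
    where
    in-box : (x , y) ∈ S → Box n x y
    in-box s = proj₁ (All.lookup members s)

    absorbing′ : Box n x y → ¬ Terminal x y → (x , y) ∉ S →
                 ∃ λ u → ∃ λ v → Move x y u v × (u , v) ∈ S
    absorbing′ b ¬t ¬s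
      with box-all {Q = Absorbed S} absorbing b
    ... | inj₁ s        = ⊥-elim (¬s s)
    ... | inj₂ (inj₁ t) = ⊥-elim (¬t t)
    ... | inj₂ (inj₂ a) with find a
    ...   | (u , v) , s , m = u , v , m , s

    open Kernel G {R = Box n} {S = λ x y → (x , y) ∈ S} box-closed
      (λ s m s′ → All.lookup (proj₂ (proj₂ (All.lookup members s))) s′ m)
      (λ s → proj₁ (proj₂ (All.lookup members s))) absorbing′

MeetsLine : Positions → Line → ℕ × ℕ → Set
MeetsLine T ℓ (u , v) = Any (λ (u′ , v′) → OnLine ℓ u v u′ v′) T

meetsLine? : ∀ T ℓ p → Dec (MeetsLine T ℓ p)
meetsLine? T ℓ (u , v) = Any.any? (λ (u′ , v′) → onLine? ℓ u v u′ v′) T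

LinesCoveredBy : Positions → Positions → Set
LinesCoveredBy S T = ∀ ℓ → All (MeetsLine T ℓ) S

linesCoveredBy? : ∀ S T → Dec (LinesCoveredBy S T)
linesCoveredBy? S T =
  map′ (λ { (r , c , d) row → r ; (r , c , d) col → c ; (r , c , d) diagonal → d })
       (λ cover → cover row , cover col , cover diagonal)
       (covers? row ×-dec covers? col ×-dec covers? diagonal)
  where
  covers? : ∀ ℓ → Dec (All (MeetsLine T ℓ) S)
  covers? ℓ = All.all? (meetsLine? T ℓ) S

redirect : ∀ {n} {S T} → LinesCoveredBy S T → (∀ {x y} → (x , y) ∈ T → Box n x y) →
           Outside n x y → Move x y u v → (u , v) ∈ S →
           ∃ λ u′ → ∃ λ v′ → Move x y u′ v′ × (u′ , v′) ∈ T
redirect cover T-box out m s with move⇒sameLine m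
... | ℓ , on with find (All.lookup (cover ℓ) s)
...   | (u′ , v′) , t , on′ =
  u′ , v′ , sameLine⇒move (ℓ , onLine-trans ℓ on on′) (outside-above-box out (T-box t)) , t

module Transfer
  {n : ℕ} {G H : QueenGame} (KG : BoxKernel n G) (KH : BoxKernel n H)
  (G-live : ∀ {x y} → Outside n x y → ¬ QueenGame.Terminal G x y)
  (H-live : ∀ {x y} → Outside n x y → ¬ QueenGame.Terminal H x y)
  (G-lines⊆H : LinesCoveredBy (BoxKernel.positions KG) (BoxKernel.positions KH))
  (H-lines⊆G : LinesCoveredBy (BoxKernel.positions KH) (BoxKernel.positions KG))
  where
  open QueenGame
  module KG = BoxKernel KG
  module KH = BoxKernel KH

  private
    P⇒P : Acc _<_ (x + y) → Outside n x y → P G x y → P H x y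
    N⇒N : Acc _<_ (x + y) → Outside n x y → N G x y → N H x y

    P⇒P {x} {y} (acc rec) out p = P-intro H (H-live out) λ u v m →
      successor (rec (move-decreases m)) m (outside⊎box n u v)
      where
      successor : Acc _<_ (u + v) → Move x y u v → Outside n u v ⊎ Box n u v → N H u v
      successor a m (inj₁ out′) = N⇒N a out′ (P-elim G p m)
      successor {u} {v} a m (inj₂ b) with (u , v) ∈? KH.positions
      ... | no ¬s = KH.N-out b ¬s
      ... | yes s with redirect H-lines⊆G KG.in-box out m s
      ...   | _ , _ , m′ , s′ = ⊥-elim (P⇒¬N G (KG.P-in s′) (P-elim G p m′))

    N⇒N (acc rec) out np with N-elim G (G-live out) np
    ... | u , v , m , p with outside⊎box n u v
    ...   | inj₁ out′ = N-intro H (H-live out) m (P⇒P (rec (move-decreases m)) out′ p)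
    ...   | inj₂ b with redirect G-lines⊆H KH.in-box out m (KG.P⇒in b p)
    ...     | _ , _ , m′ , s′ = N-intro H (H-live out) m′ (KH.P-in s′)

  transfer : Outside n x y → P G x y → P H x y
  transfer = P⇒P (<-wellFounded _)

-- (⌊kφ⌋ , ⌊kφ⌋ + k) for k ≤ 3, and their mirror images.
wythoffBoxP : Positions
wythoffBoxP = (0 , 0) ∷ (1 , 2) ∷ (2 , 1) ∷ (3 , 5) ∷ (5 , 3) ∷ (4 , 7) ∷ (7 , 4) ∷ []

misèreBoxP : Positions
misèreBoxP = (0 , 3) ∷ (3 , 0) ∷ (1 , 2) ∷ (2 , 1) ∷ (4 , 4) ∷ (5 , 7) ∷ (7 , 5) ∷ []

wythoffKernel : BoxKernel 8 wythoff
wythoffKernel = boxKernel 8 wythoff wythoffBoxP (from-yes (isBoxKernel? 8 wythoff wythoffBoxP))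

misèreKernel : BoxKernel 8 misère
misèreKernel = boxKernel 8 misère misèreBoxP (from-yes (isBoxKernel? 8 misère misèreBoxP))

wythoff-lines⊆misère : LinesCoveredBy wythoffBoxP misèreBoxP
wythoff-lines⊆misère = from-yes (linesCoveredBy? wythoffBoxP misèreBoxP)

misère-lines⊆wythoff : LinesCoveredBy misèreBoxP wythoffBoxP
misère-lines⊆wythoff = from-yes (linesCoveredBy? misèreBoxP wythoffBoxP)

outside⇒¬InT : Outside 8 x y → ¬ InT x y
outside⇒¬InT out x+y≤2 with ≤-trans (outside-≤-sum out) x+y≤2
... | s≤s (s≤s ())

theorem5p6 : (x y : ℕ) → 8 ≤ x ⊎ 8 ≤ y → (WP x y ⇔ MP x y)
theorem5p6 x y out = mk⇔
  (Transfer.transfer wythoffKernel misèreKernel (λ _ ()) outside⇒¬InT wythoff-lines⊆misère misère-lines⊆wythoff out)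
  (Transfer.transfer misèreKernel wythoffKernel outside⇒¬InT (λ _ ()) misère-lines⊆wythoff wythoff-lines⊆misère out)
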